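{- For every graph $G$ and every 2-switch $\tau$ on $G$, $|\mu(\tau(G))-\mu(G)|\le 1$, where $\mu$ denotes the matching number.
   Context: Graphs are finite and simple. A 2-switch on $G$ is specified by four distinct vertices $a,b,c,d$ with $ab,cd\in E(G)$ and $ac,bd\notin E(G)$; it produces $\tau(G)=G-ab-cd+ac+bd$. The matching number $\mu(G)$ is the maximum size of a set of pairwise disjoint edges of $G$. -}

module Defs where

open import Data.Nat using (ℕ; _⊔_; _+_; _∸_; _≤_)
open import Data.Fin using (Fin; _≟_; _<?_)
open import Data.Bool using (Bool; true; false; _∧_; _∨_; not; if_then_else_)
open import Data.List using (List; []; _∷_; map; filter; foldr; length; cartesianProduct; allFin)
open import Data.Product using (_×_; _,_; proj₁; proj₂)
open import Relation.Nullary.Decidable using (⌊_⌋)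
open import Relation.Binary.PropositionalEquality using (_≡_)
open import Relation.Nullary using () renaming (¬_ to ¬')

record Graph (n : ℕ) : Set where
  field
    adj   : Fin n → Fin n → Bool
    sym   : ∀ u v → adj u v ≡ adj v u
    irrefl : ∀ u → adj u u ≡ false
open Graph public

_==_ : ∀ {n} → Fin n → Fin n → Bool
u == v = ⌊ u ≟ v ⌋

samePair : ∀ {n} → Fin n → Fin n → Fin n → Fin n → Bool
samePair u v x y = ((u == x) ∧ (v == y)) ∨ ((u == y) ∧ (v == x))

record TwoSwitch {n : ℕ} (G : Graph n) : Set where
  field
    a b c d : Fin n
    a≢b : ¬' (a ≡ b)
    a≢c : ¬' (a ≡ c)
    a≢d : ¬' (a ≡ d)
    b≢c : ¬' (b ≡ c)
    b≢d : ¬' (b ≡ d)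
    c≢d : ¬' (c ≡ d)
    ab∈E : adj G a b ≡ true
    cd∈E : adj G c d ≡ true
    ac∉E : adj G a c ≡ false
    bd∉E : adj G b d ≡ false

switchAdj : ∀ {n} (G : Graph n) → TwoSwitch G → Fin n → Fin n → Bool
switchAdj G s u v =
  if samePair u v a b ∨ samePair u v c d then false
  else if samePair u v a c ∨ samePair u v b d then true
  else adj G u v
  where open TwoSwitch s

-- Edges are represented as pairs (u , v) with u < v and A u v = true;
-- sets of edges are the sublists of the list of all edges.
edgeList : ∀ {n} → (Fin n → Fin n → Bool) → List (Fin n × Fin n)
edgeList {n} A =
  filter (λ e → ⌊ proj₁ e <? proj₂ e ⌋ ∧ A (proj₁ e) (proj₂ e) ≟ᵇ true)
         (cartesianProduct (allFin n) (allFin n))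
  where
    open import Data.Bool.Properties using () renaming (_≟_ to _≟ᵇ_)

sublists : ∀ {X : Set} → List X → List (List X)
sublists []       = [] ∷ []
sublists (x ∷ xs) = let r = sublists xs in map (x ∷_) r ++ r
  where open import Data.List using (_++_)

disjointEdges : ∀ {n} → Fin n × Fin n → Fin n × Fin n → Bool
disjointEdges (u , v) (x , y) =
  not (u == x ∨ u == y ∨ v == x ∨ v == y)

allB : ∀ {X : Set} → (X → Bool) → List X → Bool
allB p []       = true
allB p (x ∷ xs) = p x ∧ allB p xs

isMatching : ∀ {n} → List (Fin n × Fin n) → Bool
isMatching []       = true
isMatching (e ∷ es) = allB (disjointEdges e) es ∧ isMatching es

μ : ∀ {n} → (Fin n → Fin n → Bool) → ℕ
μ A = foldr _⊔_ 0 (map length (filter (λ M → isMatching M ≟ᵇ true) (sublists (edgeList A))))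
  where
    open import Data.Bool.Properties using () renaming (_≟_ to _≟ᵇ_)

{-# OPTIONS --safe #-}
-- Delete ab and cd from a maximum matching M of G: what is left is a matching of τ(G).
-- If at most one of ab, cd lay in M this loses at most one edge; if both did, the vertices
-- a, b, c, d have become free and ac, bd can be added, so nothing is lost. Exchanging the
-- roles of G, τ(G) and of {ab, cd}, {ac, bd} gives the other inequality.
module Submission where

open import Defs
open import Data.Nat using (ℕ; _≤_; _+_)
open import Data.Product using (_×_)

open import Data.Bool using (Bool; true; false; T; _∧_; _∨_)
open import Data.Bool.Properties
  using (T-≡; T-∧; T-∨; ¬-not; ∧-conicalˡ; ∧-conicalʳ; ∧-comm; ∨-comm; ∨-zeroʳ; if-eta)
  renaming (_≟_ to _≟ᵇ_)
open import Data.Empty using (⊥; ⊥-elim)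
open import Data.Fin using (Fin; _<_; _<?_; _≟_)
open import Data.Fin.Properties using (<-asym; <-cmp)
open import Data.List using (List; []; _∷_; map; filter; length; allFin; cartesianProduct)
open import Data.List.Membership.Propositional using (_∈_; _∉_)
open import Data.List.Membership.Propositional.Properties
  using (∈-filter⁺; ∈-filter⁻; ∈-map⁺; ∈-map⁻; ∈-++⁺ˡ; ∈-++⁺ʳ; ∈-++⁻; ∈-cartesianProduct⁺; ∈-allFin)
open import Data.List.Properties using (filter-notAll; foldr-preservesᵇ; foldr-preservesᵒ)
open import Data.List.Relation.Binary.Subset.Propositional using (_⊆_)
open import Data.List.Relation.Unary.All as All using (All; []; _∷_)
open import Data.List.Relation.Unary.AllPairs as AllPairs using (AllPairs; []; _∷_)
import Data.List.Relation.Unary.AllPairs.Properties as AllPairs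
open import Data.List.Relation.Unary.Any as Any using (here; there)
open import Data.List.Relation.Unary.Unique.Propositional using (Unique)
import Data.List.Relation.Unary.Unique.Propositional.Properties as Unique
open import Data.Nat using (suc; z≤n; s≤s)
open import Data.Nat.Properties
  using (≤-trans; ≤-reflexive; n≤1+n; +-comm; ⊔-lub; m≤n⇒m≤n⊔o; m≤n⇒m≤o⊔n)
import Data.Product as Product
open import Data.Product using (∃; _,_; proj₁; proj₂)
open import Data.Product.Properties using (≡-dec)
import Data.Sum as Sum
open import Data.Sum using (_⊎_; inj₁; inj₂; [_,_]′)
open import Function using (_∘_)
open import Function.Bundles using (Equivalence)
open import Relation.Binary using (Symmetric; DecidableEquality; tri<; tri≈; tri>)
open import Relation.Binary.PropositionalEquality
  using (_≡_; _≢_; refl; trans; subst; cong; cong₂) renaming (sym to ≡-sym)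
open import Relation.Nullary using (Dec; yes; no; ¬?)
open import Relation.Nullary.Decidable using (⌊_⌋; toWitness; fromWitness)
open import Relation.Unary using (Decidable)

open Equivalence using (to; from)

private
  variable
    n : ℕ
    X : Set

∈sublists⇒⊆ : ∀ {xs ys : List X} → xs ∈ sublists ys → xs ⊆ ys
∈sublists⇒⊆ {ys = []} (here refl) ()
∈sublists⇒⊆ {ys = y ∷ ys} xs∈ x∈xs with ∈-++⁻ (map (y ∷_) (sublists ys)) xs∈
... | inj₂ xs∈′ = there (∈sublists⇒⊆ xs∈′ x∈xs)
... | inj₁ y∷zs∈ with ∈-map⁻ (y ∷_) y∷zs∈
...   | zs , zs∈ , refl with x∈xs
...     | here refl = here refl
...     | there x∈zs = there (∈sublists⇒⊆ zs∈ x∈zs)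

filter∈sublists : ∀ {P : X → Set} (P? : Decidable P) xs → filter P? xs ∈ sublists xs
filter∈sublists P? [] = here refl
filter∈sublists P? (x ∷ xs) with P? x
... | yes _ = ∈-++⁺ˡ (∈-map⁺ (x ∷_) (filter∈sublists P? xs))
... | no _ = ∈-++⁺ʳ (map (x ∷_) (sublists xs)) (filter∈sublists P? xs)

allPairs-lookup : ∀ {R : X → X → Set} {xs x y} → Symmetric R →
  AllPairs R xs → x ∈ xs → y ∈ xs → x ≢ y → R x y
allPairs-lookup _ _ (here refl) (here refl) x≢y = ⊥-elim (x≢y refl)
allPairs-lookup _ (Rx ∷ _) (here refl) (there y∈) _ = All.lookup Rx y∈
allPairs-lookup sym (Ry ∷ _) (there x∈) (here refl) _ = sym (All.lookup Ry x∈)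
allPairs-lookup sym (_ ∷ Rxs) (there x∈) (there y∈) x≢y = allPairs-lookup sym Rxs x∈ y∈ x≢y

allPairs-⊆ : ∀ {R : X → X → Set} {xs ys} → Symmetric R →
  AllPairs R ys → Unique xs → xs ⊆ ys → AllPairs R xs
allPairs-⊆ _ _ [] _ = []
allPairs-⊆ sym Rys (x∉xs ∷ xs!) xs⊆ys =
    All.tabulate (λ y∈xs → allPairs-lookup sym Rys (xs⊆ys (here refl)) (xs⊆ys (there y∈xs))
                                           (All.lookup x∉xs y∈xs))
  ∷ allPairs-⊆ sym Rys xs! (xs⊆ys ∘ there)

Unique-⊆⇒length≤ : DecidableEquality X → ∀ {xs ys : List X} →
  Unique xs → xs ⊆ ys → length xs ≤ length ys
Unique-⊆⇒length≤ _≟ₓ_ [] _ = z≤n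
Unique-⊆⇒length≤ _≟ₓ_ {x ∷ xs} {ys} (x∉xs ∷ xs!) xs⊆ys =
  ≤-trans (s≤s (Unique-⊆⇒length≤ _≟ₓ_ xs! xs⊆ys-x))
          (filter-notAll (¬? ∘ (x ≟ₓ_)) ys (Any.map (λ x≡y x≢y → x≢y x≡y) (xs⊆ys (here refl))))
  where
  xs⊆ys-x : xs ⊆ filter (¬? ∘ (x ≟ₓ_)) ys
  xs⊆ys-x y∈xs = ∈-filter⁺ (¬? ∘ (x ≟ₓ_)) (xs⊆ys (there y∈xs)) (All.lookup x∉xs y∈xs)

Edge : ℕ → Set
Edge n = Fin n × Fin n

_≟ₑ_ : DecidableEquality (Edge n)
_≟ₑ_ = ≡-dec _≟_ _≟_

_∈ᵥ_ : Fin n → Edge n → Set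
w ∈ᵥ e = w ≡ proj₁ e ⊎ w ≡ proj₂ e

Disjoint : Edge n → Edge n → Set
Disjoint e f = ∀ {w} → w ∈ᵥ e → w ∈ᵥ f → ⊥

Disjoint-sym : Symmetric (Disjoint {n})
Disjoint-sym e-f w∈f w∈e = e-f w∈e w∈f

Disjoint⇒≢ : ∀ {e f : Edge n} → Disjoint e f → e ≢ f
Disjoint⇒≢ e-e refl = e-e (inj₁ refl) (inj₁ refl)

Disjoint-covered : ∀ {e₁ e₂ f g : Edge n} → (∀ {w} → w ∈ᵥ f → w ∈ᵥ e₁ ⊎ w ∈ᵥ e₂) →
  Disjoint e₁ g → Disjoint e₂ g → Disjoint f g
Disjoint-covered covered e₁-g e₂-g w∈f w∈g =
  [ (λ w∈e₁ → e₁-g w∈e₁ w∈g) , (λ w∈e₂ → e₂-g w∈e₂ w∈g) ]′ (covered w∈f)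

Disjoint-pair : ∀ {u v x y : Fin n} → u ≢ x → u ≢ y → v ≢ x → v ≢ y → Disjoint (u , v) (x , y)
Disjoint-pair u≢x _ _ _ (inj₁ refl) (inj₁ w≡x) = u≢x w≡x
Disjoint-pair _ u≢y _ _ (inj₁ refl) (inj₂ w≡y) = u≢y w≡y
Disjoint-pair _ _ v≢x _ (inj₂ refl) (inj₁ w≡x) = v≢x w≡x
Disjoint-pair _ _ _ v≢y (inj₂ refl) (inj₂ w≡y) = v≢y w≡y

disjointEdges⇒Disjoint : ∀ {e f : Edge n} → disjointEdges e f ≡ true → Disjoint e f
disjointEdges⇒Disjoint {e = u , v} {x , y} h with u ≟ x | u ≟ y | v ≟ x | v ≟ y | h
... | no u≢x | no u≢y | no v≢x | no v≢y | _ = Disjoint-pair u≢x u≢y v≢x v≢y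
... | yes _ | _     | _     | _     | ()
... | no _  | yes _ | _     | _     | ()
... | no _  | no _  | yes _ | _     | ()
... | no _  | no _  | no _  | yes _ | ()

Disjoint⇒disjointEdges : ∀ {e f : Edge n} → Disjoint e f → disjointEdges e f ≡ true
Disjoint⇒disjointEdges {e = u , v} {x , y} e-f with u ≟ x | u ≟ y | v ≟ x | v ≟ y
... | yes u≡x | _       | _       | _       = ⊥-elim (e-f (inj₁ refl) (inj₁ u≡x))
... | no _    | yes u≡y | _       | _       = ⊥-elim (e-f (inj₁ refl) (inj₂ u≡y))
... | no _    | no _    | yes v≡x | _       = ⊥-elim (e-f (inj₂ refl) (inj₁ v≡x))
... | no _    | no _    | no _    | yes v≡y = ⊥-elim (e-f (inj₂ refl) (inj₂ v≡y))
... | no _    | no _    | no _    | no _    = refl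

IsMatching : List (Edge n) → Set
IsMatching = AllPairs Disjoint

IsMatching⇒Unique : ∀ {M : List (Edge n)} → IsMatching M → Unique M
IsMatching⇒Unique = AllPairs.map Disjoint⇒≢

allB⇒All : ∀ {p : X → Bool} {xs} → allB p xs ≡ true → All (λ x → p x ≡ true) xs
allB⇒All {xs = []} _ = []
allB⇒All {xs = _ ∷ _} h = ∧-conicalˡ _ _ h ∷ allB⇒All (∧-conicalʳ _ _ h)

All⇒allB : ∀ {p : X → Bool} {xs} → All (λ x → p x ≡ true) xs → allB p xs ≡ true
All⇒allB [] = refl
All⇒allB (px ∷ pxs) rewrite px = All⇒allB pxs

isMatching⇒IsMatching : ∀ {M : List (Edge n)} → isMatching M ≡ true → IsMatching M
isMatching⇒IsMatching {M = []} _ = []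
isMatching⇒IsMatching {M = _ ∷ _} h =
  All.map disjointEdges⇒Disjoint (allB⇒All (∧-conicalˡ _ _ h))
  ∷ isMatching⇒IsMatching (∧-conicalʳ _ _ h)

IsMatching⇒isMatching : ∀ {M : List (Edge n)} → IsMatching M → isMatching M ≡ true
IsMatching⇒isMatching [] = refl
IsMatching⇒isMatching (e-M ∷ M!)
  rewrite All⇒allB (All.map Disjoint⇒disjointEdges e-M) = IsMatching⇒isMatching M!

Adjacency : ℕ → Set
Adjacency n = Fin n → Fin n → Bool

isEdge? : (A : Adjacency n) (e : Edge n) →
  Dec ((⌊ proj₁ e <? proj₂ e ⌋ ∧ A (proj₁ e) (proj₂ e)) ≡ true)
isEdge? A e = ⌊ proj₁ e <? proj₂ e ⌋ ∧ A (proj₁ e) (proj₂ e) ≟ᵇ true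

∈edgeList⁻ : ∀ {A : Adjacency n} {x y} → (x , y) ∈ edgeList A → x < y × A x y ≡ true
∈edgeList⁻ {n} {A} {x} {y} xy∈ =
  toWitness {a? = x <? y} (from T-≡ (∧-conicalˡ _ (A x y) xy-edge)) , ∧-conicalʳ ⌊ x <? y ⌋ _ xy-edge
  where
  xy-edge : (⌊ x <? y ⌋ ∧ A x y) ≡ true
  xy-edge = proj₂ (∈-filter⁻ (isEdge? A) {xs = cartesianProduct (allFin n) (allFin n)} xy∈)

∈edgeList⁺ : ∀ {A : Adjacency n} {x y} → x < y → A x y ≡ true → (x , y) ∈ edgeList A
∈edgeList⁺ {A = A} {x} {y} x<y Axy =
  ∈-filter⁺ (isEdge? A) (∈-cartesianProduct⁺ (∈-allFin x) (∈-allFin y))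
            (trans (cong (_∧ A x y) (to T-≡ (fromWitness {a? = x <? y} x<y))) Axy)

edgeList-unique : (A : Adjacency n) → Unique (edgeList A)
edgeList-unique {n} A =
  Unique.filter⁺ (isEdge? A) (Unique.cartesianProduct⁺ (Unique.allFin⁺ n) (Unique.allFin⁺ n))

edge : Fin n → Fin n → Edge n
edge u v with u <? v
... | yes _ = u , v
... | no _ = v , u

∈ᵥ-edge⁻ : ∀ (u v : Fin n) {w} → w ∈ᵥ edge u v → w ∈ᵥ (u , v)
∈ᵥ-edge⁻ u v w∈ with u <? v
... | yes _ = w∈
... | no _ = Sum.swap w∈

∈ᵥ-edge⁺ : ∀ (u v : Fin n) {w} → w ∈ᵥ (u , v) → w ∈ᵥ edge u v
∈ᵥ-edge⁺ u v w∈ with u <? v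
... | yes _ = w∈
... | no _ = Sum.swap w∈

edge-ordered : ∀ {x y : Fin n} → x < y → edge x y ≡ (x , y)
edge-ordered {x = x} {y} x<y with x <? y
... | yes _ = refl
... | no x≮y = ⊥-elim (x≮y x<y)

edge-reversed : ∀ {x y : Fin n} → x < y → edge y x ≡ (x , y)
edge-reversed {x = x} {y} x<y with y <? x
... | yes y<x = ⊥-elim (<-asym x<y y<x)
... | no _ = refl

edge∈edgeList : ∀ {A : Adjacency n} {u v} → (∀ x y → A x y ≡ A y x) →
  u ≢ v → A u v ≡ true → edge u v ∈ edgeList A
edge∈edgeList {A = A} {u} {v} A-sym u≢v Auv with <-cmp u v
... | tri< u<v _ _ = subst (_∈ edgeList A) (≡-sym (edge-ordered u<v)) (∈edgeList⁺ u<v Auv)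
... | tri≈ _ u≡v _ = ⊥-elim (u≢v u≡v)
... | tri> _ _ v<u =
  subst (_∈ edgeList A) (≡-sym (edge-reversed v<u)) (∈edgeList⁺ v<u (trans (A-sym v u) Auv))

edge-disjoint : ∀ {u v x y : Fin n} → u ≢ x → u ≢ y → v ≢ x → v ≢ y →
  Disjoint (edge u v) (edge x y)
edge-disjoint {u = u} {v} {x} {y} u≢x u≢y v≢x v≢y w∈uv w∈xy =
  Disjoint-pair u≢x u≢y v≢x v≢y (∈ᵥ-edge⁻ u v w∈uv) (∈ᵥ-edge⁻ x y w∈xy)

edge-heads-covered : ∀ {u v x y w : Fin n} → w ∈ᵥ edge u x → w ∈ᵥ edge u v ⊎ w ∈ᵥ edge x y
edge-heads-covered {u = u} {v} {x} {y} =
  Sum.map (∈ᵥ-edge⁺ u v ∘ inj₁) (∈ᵥ-edge⁺ x y ∘ inj₁) ∘ ∈ᵥ-edge⁻ u x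

edge-tails-covered : ∀ {u v x y w : Fin n} → w ∈ᵥ edge v y → w ∈ᵥ edge u v ⊎ w ∈ᵥ edge x y
edge-tails-covered {u = u} {v} {x} {y} =
  Sum.map (∈ᵥ-edge⁺ u v ∘ inj₂) (∈ᵥ-edge⁺ x y ∘ inj₂) ∘ ∈ᵥ-edge⁻ v y

samePair⇒ : ∀ (x y u v : Fin n) → samePair x y u v ≡ true →
  (x ≡ u × y ≡ v) ⊎ (x ≡ v × y ≡ u)
samePair⇒ _ _ _ _ h = Sum.map witnesses witnesses (to T-∨ (from T-≡ h))
  where
  witnesses : ∀ {a b c d : Fin _} → T ((a == b) ∧ (c == d)) → a ≡ b × c ≡ d
  witnesses {a = a} {b} {c} {d} t =
    Product.map (toWitness {a? = a ≟ b}) (toWitness {a? = c ≟ d}) (to T-∧ t)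

samePair⇒≡edge : ∀ {x y u v : Fin n} → x < y → samePair x y u v ≡ true → (x , y) ≡ edge u v
samePair⇒≡edge {x = x} {y} {u} {v} x<y h with samePair⇒ x y u v h
... | inj₁ (refl , refl) = ≡-sym (edge-ordered x<y)
... | inj₂ (refl , refl) = ≡-sym (edge-reversed x<y)

≢edge⇒¬samePair : ∀ {x y u v : Fin n} → x < y → (x , y) ≢ edge u v → samePair x y u v ≡ false
≢edge⇒¬samePair x<y xy≢uv = ¬-not (xy≢uv ∘ samePair⇒≡edge x<y)

≢⇒¬samePairˡ : ∀ {x u v : Fin n} y → x ≢ u → x ≢ v → samePair x y u v ≡ false
≢⇒¬samePairˡ {x = x} {u} {v} y x≢u x≢v =
  ¬-not ([ x≢u ∘ proj₁ , x≢v ∘ proj₁ ]′ ∘ samePair⇒ x y u v)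

≢⇒¬samePairʳ : ∀ {y u v : Fin n} x → y ≢ u → y ≢ v → samePair x y u v ≡ false
≢⇒¬samePairʳ {y = y} {u} {v} x y≢u y≢v =
  ¬-not ([ y≢v ∘ proj₂ , y≢u ∘ proj₂ ]′ ∘ samePair⇒ x y u v)

samePair-refl : ∀ (u v : Fin n) → samePair u v u v ≡ true
samePair-refl u v =
  to T-≡ (from T-∨ (inj₁ (from T-∧ (fromWitness {a? = u ≟ u} refl , fromWitness {a? = v ≟ v} refl))))

samePair-comm : ∀ (u v x y : Fin n) → samePair u v x y ≡ samePair v u x y
samePair-comm u v x y =
  trans (∨-comm (u == x ∧ v == y) _) (cong₂ _∨_ (∧-comm (u == y) _) (∧-comm (u == x) _))

μ-lub : ∀ {A : Adjacency n} {k} →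
  (∀ {M} → M ∈ sublists (edgeList A) → IsMatching M → length M ≤ k) → μ A ≤ k
μ-lub {A = A} {k} bound = foldr-preservesᵇ {P = _≤ k} ⊔-lub z≤n (All.tabulate matching-length≤k)
  where
  matching-length≤k : ∀ {m} →
    m ∈ map length (filter (λ M → isMatching M ≟ᵇ true) (sublists (edgeList A))) → m ≤ k
  matching-length≤k m∈ with ∈-map⁻ length m∈
  ... | M , M∈ , refl with ∈-filter⁻ (λ M → isMatching M ≟ᵇ true) {xs = sublists (edgeList A)} M∈
  ...   | M∈sublists , M-matching = bound M∈sublists (isMatching⇒IsMatching M-matching)

sublist-matching≤μ : ∀ {A : Adjacency n} {M} →
  M ∈ sublists (edgeList A) → IsMatching M → length M ≤ μ A
sublist-matching≤μ {M = M} M∈ M-matching =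
  foldr-preservesᵒ {P = length M ≤_} (λ x y → [ m≤n⇒m≤n⊔o y , m≤n⇒m≤o⊔n x ]′) 0 _
    (inj₂ (Any.map ≤-reflexive (∈-map⁺ length
      (∈-filter⁺ (λ M → isMatching M ≟ᵇ true) M∈ (IsMatching⇒isMatching M-matching)))))

record Exchange (A B : Adjacency n) : Set where
  field
    e₁ e₂ f₁ f₂ : Edge n
    kept : ∀ {e} → e ∈ edgeList A → e ≢ e₁ → e ≢ e₂ → e ∈ edgeList B
    f₁∈B : f₁ ∈ edgeList B
    f₂∈B : f₂ ∈ edgeList B
    f₁-f₂-disjoint : Disjoint f₁ f₂
    f₁-covered : ∀ {w} → w ∈ᵥ f₁ → w ∈ᵥ e₁ ⊎ w ∈ᵥ e₂
    f₂-covered : ∀ {w} → w ∈ᵥ f₂ → w ∈ᵥ e₁ ⊎ w ∈ᵥ e₂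

module _ {n : ℕ} where
  open import Data.List.Membership.DecPropositional (_≟ₑ_ {n}) using (_∈?_; _∉?_)

  matching≤μ : ∀ {A : Adjacency n} {M} → IsMatching M → M ⊆ edgeList A → length M ≤ μ A
  matching≤μ {A = A} {M} M-matching M⊆A =
    ≤-trans (Unique-⊆⇒length≤ _≟ₑ_ (IsMatching⇒Unique M-matching) M⊆S)
            (sublist-matching≤μ (filter∈sublists (_∈? M) (edgeList A)) S-matching)
    where
    S : List (Edge n)
    S = filter (_∈? M) (edgeList A)
    M⊆S : M ⊆ S
    M⊆S e∈M = ∈-filter⁺ (_∈? M) (M⊆A e∈M) e∈M
    S-matching : IsMatching S
    S-matching = allPairs-⊆ Disjoint-sym M-matching (Unique.filter⁺ (_∈? M) (edgeList-unique A))
                            (proj₂ ∘ ∈-filter⁻ (_∈? M) {xs = edgeList A})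

  module _ {A B : Adjacency n} (ex : Exchange A B) where
    open Exchange ex

    module _ {M} (M-matching : IsMatching M) (M⊆A : M ⊆ edgeList A) where
      private
        R : List (Edge n)
        R = filter (_∉? e₁ ∷ e₂ ∷ []) M

        ∈R⁻ : ∀ {e} → e ∈ R → e ∈ M × e ≢ e₁ × e ≢ e₂
        ∈R⁻ e∈R = let (e∈M , e∉e₁e₂) = ∈-filter⁻ (_∉? e₁ ∷ e₂ ∷ []) {xs = M} e∈R
                  in e∈M , e∉e₁e₂ ∘ here , e∉e₁e₂ ∘ there ∘ here

        R-matching : IsMatching R
        R-matching = AllPairs.filter⁺ (_∉? e₁ ∷ e₂ ∷ []) M-matching

        R⊆B : R ⊆ edgeList B
        R⊆B e∈R = let (e∈M , e≢e₁ , e≢e₂) = ∈R⁻ e∈R in kept (M⊆A e∈M) e≢e₁ e≢e₂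

        length≤ : ∀ {L} → M ⊆ L → length M ≤ length L
        length≤ = Unique-⊆⇒length≤ _≟ₑ_ (IsMatching⇒Unique M-matching)

        M⊆e₁e₂R : M ⊆ e₁ ∷ e₂ ∷ R
        M⊆e₁e₂R {e} e∈M with e ∈? e₁ ∷ e₂ ∷ []
        ... | yes e∈e₁e₂ = ∈-++⁺ˡ e∈e₁e₂
        ... | no e∉e₁e₂ = ∈-++⁺ʳ (e₁ ∷ e₂ ∷ []) (∈-filter⁺ (_∉? e₁ ∷ e₂ ∷ []) e∈M e∉e₁e₂)

        M⊆e₂R : e₁ ∉ M → M ⊆ e₂ ∷ R
        M⊆e₂R e₁∉M e∈M with M⊆e₁e₂R e∈M
        ... | here refl = ⊥-elim (e₁∉M e∈M)
        ... | there e∈e₂R = e∈e₂R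

        M⊆e₁R : e₂ ∉ M → M ⊆ e₁ ∷ R
        M⊆e₁R e₂∉M e∈M with M⊆e₁e₂R e∈M
        ... | here e≡e₁ = here e≡e₁
        ... | there (here refl) = ⊥-elim (e₂∉M e∈M)
        ... | there (there e∈R) = there e∈R

        -- Every edge left in R avoids e₁ and e₂, hence also f₁ and f₂.
        exchanged-matching : e₁ ∈ M → e₂ ∈ M → IsMatching (f₁ ∷ f₂ ∷ R)
        exchanged-matching e₁∈M e₂∈M =
            (f₁-f₂-disjoint ∷ All.tabulate (avoids f₁-covered))
          ∷ All.tabulate (avoids f₂-covered)
          ∷ R-matching
          where
          avoids : ∀ {f g} → (∀ {w} → w ∈ᵥ f → w ∈ᵥ e₁ ⊎ w ∈ᵥ e₂) → g ∈ R → Disjoint f g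
          avoids covered g∈R =
            let (g∈M , g≢e₁ , g≢e₂) = ∈R⁻ g∈R in
            Disjoint-covered covered
              (allPairs-lookup Disjoint-sym M-matching e₁∈M g∈M (g≢e₁ ∘ ≡-sym))
              (allPairs-lookup Disjoint-sym M-matching e₂∈M g∈M (g≢e₂ ∘ ≡-sym))

        exchanged⊆B : f₁ ∷ f₂ ∷ R ⊆ edgeList B
        exchanged⊆B (here refl) = f₁∈B
        exchanged⊆B (there (here refl)) = f₂∈B
        exchanged⊆B (there (there e∈R)) = R⊆B e∈R

      exchange-matching : ∃ λ M′ → IsMatching M′ × M′ ⊆ edgeList B × length M ≤ suc (length M′)
      exchange-matching with e₁ ∈? M | e₂ ∈? M
      ... | yes e₁∈M | yes e₂∈M = f₁ ∷ f₂ ∷ R , exchanged-matching e₁∈M e₂∈M , exchanged⊆B ,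
                                  ≤-trans (length≤ M⊆e₁e₂R) (n≤1+n _)
      ... | no e₁∉M  | _        = R , R-matching , R⊆B , length≤ (M⊆e₂R e₁∉M)
      ... | yes _    | no e₂∉M  = R , R-matching , R⊆B , length≤ (M⊆e₁R e₂∉M)

    μ-exchange : μ A ≤ μ B + 1
    μ-exchange = μ-lub λ M∈ M-matching →
      let (M′ , M′-matching , M′⊆B , M≤1+M′) = exchange-matching M-matching (∈sublists⇒⊆ M∈) in
      ≤-trans M≤1+M′ (subst (suc (length M′) ≤_) (+-comm 1 (μ B))
                            (s≤s (matching≤μ M′-matching M′⊆B)))

module _ {n : ℕ} (G : Graph n) (s : TwoSwitch G) where
  open TwoSwitch s

  switchAdj-sym : ∀ x y → switchAdj G s x y ≡ switchAdj G s y x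
  switchAdj-sym x y
    rewrite samePair-comm x y a b | samePair-comm x y c d
          | samePair-comm x y a c | samePair-comm x y b d
          | Graph.sym G x y = refl

  switchAdj-preserves : ∀ x y → samePair x y a b ≡ false → samePair x y c d ≡ false →
    adj G x y ≡ true → switchAdj G s x y ≡ true
  switchAdj-preserves _ _ ¬ab ¬cd Gxy rewrite ¬ab | ¬cd | Gxy = if-eta _

  switchAdj-reflects : ∀ x y → samePair x y a c ≡ false → samePair x y b d ≡ false →
    switchAdj G s x y ≡ true → adj G x y ≡ true
  switchAdj-reflects x y ¬ac ¬bd τxy rewrite ¬ac | ¬bd
    with samePair x y a b ∨ samePair x y c d | τxy
  ... | false | Gxy = Gxy
  ... | true | ()

  switchAdj-adds : ∀ x y → samePair x y a b ≡ false → samePair x y c d ≡ false →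
    samePair x y a c ∨ samePair x y b d ≡ true → switchAdj G s x y ≡ true
  switchAdj-adds _ _ ¬ab ¬cd new rewrite ¬ab | ¬cd | new = refl

  switchAdj-ac : switchAdj G s a c ≡ true
  switchAdj-ac = switchAdj-adds a c
    (≢⇒¬samePairʳ a (a≢c ∘ ≡-sym) (b≢c ∘ ≡-sym)) (≢⇒¬samePairˡ c a≢c a≢d)
    (cong (_∨ samePair a c b d) (samePair-refl a c))

  switchAdj-bd : switchAdj G s b d ≡ true
  switchAdj-bd = switchAdj-adds b d
    (≢⇒¬samePairʳ b (a≢d ∘ ≡-sym) (b≢d ∘ ≡-sym)) (≢⇒¬samePairˡ d b≢c b≢d)
    (trans (cong (samePair b d a c ∨_) (samePair-refl b d)) (∨-zeroʳ _))

  switch-exchange : Exchange (adj G) (switchAdj G s)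
  switch-exchange = record
    { e₁ = edge a b ; e₂ = edge c d ; f₁ = edge a c ; f₂ = edge b d
    ; kept = kept
    ; f₁∈B = edge∈edgeList switchAdj-sym a≢c switchAdj-ac
    ; f₂∈B = edge∈edgeList switchAdj-sym b≢d switchAdj-bd
    ; f₁-f₂-disjoint = edge-disjoint a≢b a≢d (b≢c ∘ ≡-sym) c≢d
    ; f₁-covered = edge-heads-covered {u = a} {b} {c} {d}
    ; f₂-covered = edge-tails-covered {u = a} {b} {c} {d}
    }
    where
    kept : ∀ {e} → e ∈ edgeList (adj G) → e ≢ edge a b → e ≢ edge c d →
      e ∈ edgeList (switchAdj G s)
    kept {x , y} xy∈G xy≢ab xy≢cd =
      let (x<y , Gxy) = ∈edgeList⁻ xy∈G in
      ∈edgeList⁺ x<y (switchAdj-preserves x y (≢edge⇒¬samePair x<y xy≢ab)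
                                              (≢edge⇒¬samePair x<y xy≢cd) Gxy)

  unswitch-exchange : Exchange (switchAdj G s) (adj G)
  unswitch-exchange = record
    { e₁ = edge a c ; e₂ = edge b d ; f₁ = edge a b ; f₂ = edge c d
    ; kept = kept
    ; f₁∈B = edge∈edgeList (Graph.sym G) a≢b ab∈E
    ; f₂∈B = edge∈edgeList (Graph.sym G) c≢d cd∈E
    ; f₁-f₂-disjoint = edge-disjoint a≢c a≢d b≢c b≢d
    ; f₁-covered = edge-heads-covered {u = a} {c} {b} {d}
    ; f₂-covered = edge-tails-covered {u = a} {c} {b} {d}
    }
    where
    kept : ∀ {e} → e ∈ edgeList (switchAdj G s) → e ≢ edge a c → e ≢ edge b d →
      e ∈ edgeList (adj G)
    kept {x , y} xy∈τ xy≢ac xy≢bd =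
      let (x<y , τxy) = ∈edgeList⁻ xy∈τ in
      ∈edgeList⁺ x<y (switchAdj-reflects x y (≢edge⇒¬samePair x<y xy≢ac)
                                             (≢edge⇒¬samePair x<y xy≢bd) τxy)

mainTheorem9 : ∀ {n : ℕ} (G : Graph n) (s : TwoSwitch G) →
    (μ (switchAdj G s) ≤ μ (adj G) + 1) × (μ (adj G) ≤ μ (switchAdj G s) + 1)
mainTheorem9 G s = μ-exchange (unswitch-exchange G s) , μ-exchange (switch-exchange G s)
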